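{- Let $G$ be a graph and $v\in V(G)$. Then $v$ belongs to every MEG-set of $G$ if and only if there exists $u\in N(v)$ such that for every vertex $x\in N(v)$, every induced $2$-path $uvx$ is part of a $4$-cycle (i.e., there is a vertex $w\neq v$ adjacent to both $u$ and $x$, so that $uvxwu$ is a $4$-cycle).
   Context: All graphs are finite and simple; $N(v)$ denotes the open neighbourhood of $v$. A pair of vertices $u,v$ (or any vertex set containing them) monitors an edge $e$ if $e$ lies on every shortest $u$–$v$ path. A monitoring edge-geodetic set (MEG-set) of $G$ is a set $M\subseteq V(G)$ such that every edge of $G$ is monitored by some pair of vertices of $M$. An induced $2$-path is an ordered triple of vertices $u,v,x$ with $u,x$ both adjacent to $v$ and $u$ not adjacent to $x$. -}

module Defs where

open import Data.Nat using (ℕ; zero; suc; _≤_)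
open import Data.Fin using (Fin)
open import Data.Fin.Subset using (Subset; _∈_)
open import Data.Bool using (Bool; true; false)
open import Data.Product using (Σ; ∃; ∃-syntax; _×_; _,_)
open import Data.Sum using (_⊎_)
open import Relation.Binary.PropositionalEquality using (_≡_; _≢_)
open import Relation.Nullary using (¬_)

record Graph (n : ℕ) : Set where
  field
    adj    : Fin n → Fin n → Bool
    sym    : ∀ a b → adj a b ≡ adj b a
    irrefl : ∀ a → adj a a ≡ false

module _ {n : ℕ} (G : Graph n) where
  open Graph G

  Adj : Fin n → Fin n → Set
  Adj a b = adj a b ≡ true

  data Walk : Fin n → Fin n → ℕ → Set where
    nil  : ∀ u → Walk u u zero
    cons : ∀ {u w v k} → Adj u w → Walk w v k → Walk u v (suc k)

  data EdgeOn (a b : Fin n) : ∀ {u v k} → Walk u v k → Set where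
    here  : ∀ {u w v k} (h : Adj u w) (p : Walk w v k) →
            (u ≡ a × w ≡ b) ⊎ (u ≡ b × w ≡ a) → EdgeOn a b (cons h p)
    there : ∀ {u w v k} (h : Adj u w) (p : Walk w v k) →
            EdgeOn a b p → EdgeOn a b (cons h p)

  -- A shortest u–v path: a u–v walk of minimum length (automatically a path).
  IsShortest : ∀ {u v k} → Walk u v k → Set
  IsShortest {u} {v} {k} _ = ∀ k' → Walk u v k' → k ≤ k'

  Monitors : Fin n → Fin n → Fin n → Fin n → Set
  Monitors u v a b =
    (∃[ k ] Walk u v k) ×
    (∀ k (p : Walk u v k) → IsShortest p → EdgeOn a b p)

  IsMEG : Subset n → Set
  IsMEG M = ∀ a b → Adj a b →
    ∃[ u ] ∃[ v ] (u ∈ M × v ∈ M × Monitors u v a b)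

  Induced2Path : Fin n → Fin n → Fin n → Set
  Induced2Path u v x = Adj u v × Adj x v × u ≢ x × ¬ Adj u x

{-# OPTIONS --safe #-}
-- If u ∈ N(v) has this property and s, t ≠ v monitored uv, a shortest s–t walk through uv
-- could be oriented as s … u v x … t (x exists because t ≠ v; reverse the walk
-- otherwise). Minimality makes uvx an induced 2-path, and replacing v by the fourth
-- vertex w of its 4-cycle gives an equally short walk avoiding uv.
-- Conversely, if v has no such neighbour then V ∖ {v} is an MEG-set: an edge avoiding
-- v is monitored by its ends, and an edge uv by u and x, where uvx is an induced
-- 2-path on no 4-cycle, so that u v x is the only shortest u–x walk.
module Submission where

open import Defs
open import Data.Nat using (ℕ; zero; suc; _+_; _≤_; _<_; s≤s; z<s)
open import Data.Nat.Properties
  using (+-comm; +-suc; +-cancelˡ-≤; +-cancelʳ-≤; +-monoʳ-≤; +-monoˡ-<; m<m+n; m≤n+m;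
         <-irrefl; ≮⇒≥; anyUpTo?; module ≤-Reasoning)
open import Data.Nat.Induction using (<-wellFounded)
open import Induction.WellFounded using (Acc; acc)
open import Data.Fin using (Fin; _≟_)
open import Data.Fin.Properties using (any?; all?)
open import Data.Fin.Subset using (Subset; _∈_; ∁; ⁅_⁆)
open import Data.Fin.Subset.Properties using (_∈?_; x∈⁅x⁆; x≢y⇒x∉⁅y⁆; x∉p⇒x∈∁p; x∈∁p⇒x∉p)
open import Data.Bool using (true)
import Data.Bool.Properties as Bool
open import Data.Product using (Σ; ∃; ∃₂; ∃-syntax; _×_; _,_)
open import Data.Sum using (_⊎_; inj₁; inj₂)
import Data.Sum as Sum
open import Relation.Nullary using (¬_; Dec; yes; no; contradiction)
open import Relation.Nullary.Decidable using (_×-dec_; _→-dec_; ¬?; map′; decidable-stable)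
open import Relation.Binary.PropositionalEquality using (_≡_; _≢_; refl; sym; trans; subst)
open import Function.Bundles using (_⇔_; mk⇔)

x≢y⇒x∈∁⁅y⁆ : ∀ {n} {x y : Fin n} → x ≢ y → x ∈ ∁ ⁅ y ⁆
x≢y⇒x∈∁⁅y⁆ x≢y = x∉p⇒x∈∁p (x≢y⇒x∉⁅y⁆ x≢y)

module _ {n : ℕ} (G : Graph n) where

  Adj-sym : ∀ {a b} → Adj G a b → Adj G b a
  Adj-sym {a} {b} h = trans (Graph.sym G b a) h

  Adj⇒≢ : ∀ {a b} → Adj G a b → a ≢ b
  Adj⇒≢ {a} h refl = contradiction (trans (sym h) (Graph.irrefl G a)) λ ()

  Adj? : ∀ a b → Dec (Adj G a b)
  Adj? a b = Graph.adj G a b Bool.≟ true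

  infixr 5 _++_
  _++_ : ∀ {s m t i j} → Walk G s m i → Walk G m t j → Walk G s t (i + j)
  nil _    ++ q = q
  cons h p ++ q = cons h (p ++ q)

  infixl 5 _∷ʳ_
  _∷ʳ_ : ∀ {s m t k} → Walk G s m k → Adj G m t → Walk G s t (suc k)
  nil _    ∷ʳ h = cons h (nil _)
  cons h p ∷ʳ h′ = cons h (p ∷ʳ h′)

  reverse : ∀ {s t k} → Walk G s t k → Walk G t s k
  reverse (nil s)    = nil s
  reverse (cons h p) = reverse p ∷ʳ Adj-sym h

  Walk₀⇒≡ : ∀ {s t} → Walk G s t 0 → s ≡ t
  Walk₀⇒≡ (nil _) = refl

  Walk? : ∀ k s t → Dec (Walk G s t k)
  Walk? zero    s t = map′ (λ { refl → nil s }) Walk₀⇒≡ (s ≟ t)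
  Walk? (suc k) s t = map′ (λ { (_ , h , p) → cons h p }) (λ { (cons h p) → _ , h , p })
                           (any? λ w → Adj? s w ×-dec Walk? k w t)

  shortest : ∀ {s t K} → Walk G s t K → ∃[ k ] Σ (Walk G s t k) (IsShortest G)
  shortest {s} {t} {K} = descend (<-wellFounded K)
    where
    descend : ∀ {K} → Acc _<_ K → Walk G s t K → ∃[ k ] Σ (Walk G s t k) (IsShortest G)
    descend {K} (acc shorter) p with anyUpTo? (λ k → Walk? k s t) K
    ... | yes (k , k<K , q) = descend (shorter k<K) q
    ... | no none           = K , p , λ k q → ≮⇒≥ λ k<K → none (k , k<K , q)

  IsShortest-++ˡ : ∀ {s m t i j} (p : Walk G s m i) (q : Walk G m t j) →
    IsShortest G (p ++ q) → IsShortest G p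
  IsShortest-++ˡ {j = j} p q pq-short k p′ = +-cancelʳ-≤ j _ k (pq-short _ (p′ ++ q))

  IsShortest-++ʳ : ∀ {s m t i j} (p : Walk G s m i) (q : Walk G m t j) →
    IsShortest G (p ++ q) → IsShortest G q
  IsShortest-++ʳ {i = i} p q pq-short k q′ = +-cancelˡ-≤ i _ k (pq-short _ (p ++ q′))

  shortest⇒Induced2Path : ∀ {u v x} (huv : Adj G u v) (hvx : Adj G v x) →
    IsShortest G (cons huv (cons hvx (nil x))) → Induced2Path G u v x
  shortest⇒Induced2Path {u} {v} {x} huv hvx uvx-short = huv , Adj-sym hvx , u≢x , u≁x
    where
    u≢x : u ≢ x
    u≢x refl with uvx-short 0 (nil _)
    ... | ()
    u≁x : ¬ Adj G u x
    u≁x hux with uvx-short 1 (cons hux (nil _))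
    ... | s≤s ()

  data _∈ᵂ_ (y : Fin n) : ∀ {s t k} → Walk G s t k → Set where
    start : ∀ {t k} (p : Walk G y t k) → y ∈ᵂ p
    later : ∀ {s w t k} (h : Adj G s w) {p : Walk G w t k} → y ∈ᵂ p → y ∈ᵂ cons h p

  ∈ᵂ-split : ∀ {y s t k} {p : Walk G s t k} → y ∈ᵂ p →
    ∃₂ λ i j → Walk G s y i × Walk G y t j × i + j ≡ k
  ∈ᵂ-split (start p)   = 0 , _ , nil _ , p , refl
  ∈ᵂ-split (later h e) with ∈ᵂ-split e
  ... | i , j , p₁ , p₂ , refl = suc i , j , cons h p₁ , p₂ , refl

  shortest-halves-meet-at-junction : ∀ {y s m t i j} (p : Walk G s m i) (q : Walk G m t j) →
    IsShortest G (p ++ q) → y ∈ᵂ p → y ∈ᵂ q → y ≡ m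
  shortest-halves-meet-at-junction p q pq-short y∈p y∈q with ∈ᵂ-split y∈p | ∈ᵂ-split y∈q
  ... | _ , _ , _ , nil _ , refl | _ = refl
  ... | a , suc b , p₁ , cons _ _ , refl | c , d , _ , q₂ , refl =
    contradiction (pq-short _ (p₁ ++ q₂)) λ le → <-irrefl refl (begin-strict
      a + d                 ≤⟨ +-monoʳ-≤ a (m≤n+m d c) ⟩
      a + (c + d)           <⟨ +-monoˡ-< (c + d) (m<m+n a z<s) ⟩
      a + suc b + (c + d)   ≤⟨ le ⟩
      a + d                 ∎)
    where open ≤-Reasoning

  EdgeOn-sym : ∀ {a b s t k} {p : Walk G s t k} → EdgeOn G a b p → EdgeOn G b a p
  EdgeOn-sym (here h p e)  = here h p (Sum.swap e)
  EdgeOn-sym (there h p e) = there h p (EdgeOn-sym e)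

  EdgeOn⇒∈ᵂ : ∀ {a b s t k} {p : Walk G s t k} → EdgeOn G a b p → b ∈ᵂ p
  EdgeOn⇒∈ᵂ (here h p (inj₁ (refl , refl))) = later h (start p)
  EdgeOn⇒∈ᵂ (here h p (inj₂ (refl , refl))) = start (cons h p)
  EdgeOn⇒∈ᵂ (there h p e)                   = later h (EdgeOn⇒∈ᵂ e)

  EdgeOn-++⁻ : ∀ {a b s m t i j} (p : Walk G s m i) {q : Walk G m t j} →
    EdgeOn G a b (p ++ q) → EdgeOn G a b p ⊎ EdgeOn G a b q
  EdgeOn-++⁻ (nil _)    e             = inj₂ e
  EdgeOn-++⁻ (cons h p) (here _ _ e)  = inj₁ (here h p e)
  EdgeOn-++⁻ (cons h p) (there _ _ e) = Sum.map₁ (there h p) (EdgeOn-++⁻ p e)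

  EdgeOn-∷ʳ⁻ : ∀ {a b s m t k} (p : Walk G s m k) (h : Adj G m t) →
    EdgeOn G a b (p ∷ʳ h) → EdgeOn G a b p ⊎ EdgeOn G a b (cons h (nil t))
  EdgeOn-∷ʳ⁻ (nil _)     h e             = inj₂ e
  EdgeOn-∷ʳ⁻ (cons h′ p) h (here _ _ e)  = inj₁ (here h′ p e)
  EdgeOn-∷ʳ⁻ (cons h′ p) h (there _ _ e) = Sum.map₁ (there h′ p) (EdgeOn-∷ʳ⁻ p h e)

  EdgeOn-reverse⁻ : ∀ {a b s t k} (p : Walk G s t k) → EdgeOn G a b (reverse p) → EdgeOn G a b p
  EdgeOn-reverse⁻ (cons h p) e with EdgeOn-∷ʳ⁻ (reverse p) (Adj-sym h) e
  ... | inj₁ e′                                = there h p (EdgeOn-reverse⁻ p e′)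
  ... | inj₂ (here _ _ (inj₁ (refl , refl))) = here h p (inj₂ (refl , refl))
  ... | inj₂ (here _ _ (inj₂ (refl , refl))) = here h p (inj₁ (refl , refl))

  EdgeSplit : Fin n → Fin n → Fin n → Fin n → ℕ → Set
  EdgeSplit s a b t k = ∃₂ λ i j → Walk G s a i × Adj G a b × Walk G b t j × i + suc j ≡ k

  EdgeSplit-cons : ∀ {s w a b t k} → Adj G s w → EdgeSplit w a b t k → EdgeSplit s a b t (suc k)
  EdgeSplit-cons h (i , j , p₁ , hab , p₂ , refl) = suc i , j , cons h p₁ , hab , p₂ , refl

  EdgeOn-split : ∀ {a b s t k} {p : Walk G s t k} → EdgeOn G a b p →
    EdgeSplit s a b t k ⊎ EdgeSplit s b a t k
  EdgeOn-split (here h p (inj₁ (refl , refl))) = inj₁ (0 , _ , nil _ , h , p , refl)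
  EdgeOn-split (here h p (inj₂ (refl , refl))) = inj₂ (0 , _ , nil _ , h , p , refl)
  EdgeOn-split (there h p e) = Sum.map (EdgeSplit-cons h) (EdgeSplit-cons h) (EdgeOn-split e)

  Monitors-sym : ∀ {s t a b} → Monitors G s t a b → Monitors G t s a b
  Monitors-sym ((k , p) , through) =
    (k , reverse p) , λ k q q-short → EdgeOn-reverse⁻ q (through k (reverse q) λ k′ r → q-short k′ (reverse r))

  Monitors-swapEdge : ∀ {s t a b} → Monitors G s t a b → Monitors G s t b a
  Monitors-swapEdge (walk , through) = walk , λ k p p-short → EdgeOn-sym (through k p p-short)

  Adj⇒Monitors : ∀ {a b} → Adj G a b → Monitors G a b a b
  Adj⇒Monitors {a} {b} hab = (1 , ab) , through
    where
    ab : Walk G a b 1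
    ab = cons hab (nil b)
    through : ∀ k (p : Walk G a b k) → IsShortest G p → EdgeOn G a b p
    through zero          p               _       = contradiction (Walk₀⇒≡ p) (Adj⇒≢ hab)
    through (suc zero)    (cons h (nil _)) _       = here h (nil _) (inj₁ (refl , refl))
    through (suc (suc k)) p               p-short with p-short 1 ab
    ... | s≤s ()

  OnFourCycle : Fin n → Fin n → Fin n → Set
  OnFourCycle u v x = ∃[ w ] (w ≢ v × Adj G u w × Adj G x w)

  ForcingNeighbour : Fin n → Fin n → Set
  ForcingNeighbour v u = Adj G v u × (∀ x → Adj G v x → Induced2Path G u v x → OnFourCycle u v x)

  Induced2Path? : ∀ u v x → Dec (Induced2Path G u v x)
  Induced2Path? u v x = Adj? u v ×-dec Adj? x v ×-dec ¬? (u ≟ x) ×-dec ¬? (Adj? u x)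

  OnFourCycle? : ∀ u v x → Dec (OnFourCycle u v x)
  OnFourCycle? u v x = any? λ w → ¬? (w ≟ v) ×-dec Adj? u w ×-dec Adj? x w

  ForcingNeighbour? : ∀ v u → Dec (ForcingNeighbour v u)
  ForcingNeighbour? v u =
    Adj? v u ×-dec all? λ x → Adj? v x →-dec Induced2Path? u v x →-dec OnFourCycle? u v x

  ¬ForcingNeighbour⇒open-2path : ∀ {v u} → Adj G v u → ¬ ForcingNeighbour v u →
    ∃[ x ] (Adj G v x × Induced2Path G u v x × ¬ OnFourCycle u v x)
  ¬ForcingNeighbour⇒open-2path {v} {u} hvu ¬forcing =
    decidable-stable (any? λ x → Adj? v x ×-dec Induced2Path? u v x ×-dec ¬? (OnFourCycle? u v x))
      λ none → ¬forcing (hvu , λ x hvx uvx →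
        decidable-stable (OnFourCycle? u v x) λ ¬square → none (x , hvx , uvx , ¬square))

  open-2path⇒Monitors : ∀ {u v x} → Induced2Path G u v x → ¬ OnFourCycle u v x → Monitors G u x u v
  open-2path⇒Monitors {u} {v} {x} (huv , hxv , u≢x , u≁x) ¬square = (2 , uvx) , through
    where
    uvx : Walk G u x 2
    uvx = cons huv (cons (Adj-sym hxv) (nil x))
    through : ∀ k (p : Walk G u x k) → IsShortest G p → EdgeOn G u v p
    through zero p _ = contradiction (Walk₀⇒≡ p) u≢x
    through (suc zero) (cons hux (nil _)) _ = contradiction hux u≁x
    through (suc (suc zero)) (cons {w = w} huw (cons hwx (nil _))) _ with w ≟ v
    ... | yes refl = here huw _ (inj₁ (refl , refl))
    ... | no w≢v   = contradiction (w , w≢v , huw , Adj-sym hwx) ¬square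
    through (suc (suc (suc k))) p p-short with p-short 2 uvx
    ... | s≤s (s≤s ())

  ForcingNeighbour⇒¬Monitors-via : ∀ {v u s t i j} → ForcingNeighbour v u → t ≢ v →
    (p₁ : Walk G s u i) (huv : Adj G u v) (p₂ : Walk G v t j) →
    IsShortest G (p₁ ++ cons huv p₂) → ¬ Monitors G s t u v
  ForcingNeighbour⇒¬Monitors-via _ t≢v _ _ (nil _) _ _ = t≢v refl
  ForcingNeighbour⇒¬Monitors-via {v} {u} (_ , square) _ p₁ huv (cons {w = x} hvx p₃) p-short (_ , through) =
    reroute (square x hvx uvx-induced)
    where
    uvx : Walk G u x 2
    uvx = cons huv (cons hvx (nil x))
    uvx++p₃-short : IsShortest G (uvx ++ p₃)
    uvx++p₃-short = IsShortest-++ʳ p₁ (uvx ++ p₃) p-short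
    uvx-induced : Induced2Path G u v x
    uvx-induced = shortest⇒Induced2Path huv hvx (IsShortest-++ˡ uvx p₃ uvx++p₃-short)
    u≢x : u ≢ x
    u≢x = let (_ , _ , u≢x , _) = uvx-induced in u≢x
    reroute : ¬ OnFourCycle u v x
    reroute (w , w≢v , huw , hxw) with EdgeOn-++⁻ p₁ (through _ (p₁ ++ cons huw (cons (Adj-sym hxw) p₃)) p-short)
    ... | inj₁ e = Adj⇒≢ huv (sym (shortest-halves-meet-at-junction p₁ (uvx ++ p₃) p-short
                                     (EdgeOn⇒∈ᵂ e) (later huv (start _))))
    ... | inj₂ (here _ _ (inj₁ (_ , w≡v)))             = w≢v w≡v
    ... | inj₂ (here _ _ (inj₂ (u≡v , _)))             = Adj⇒≢ huv u≡v
    ... | inj₂ (there _ _ (here _ _ (inj₁ (w≡u , _)))) = Adj⇒≢ huw (sym w≡u)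
    ... | inj₂ (there _ _ (here _ _ (inj₂ (w≡v , _)))) = w≢v w≡v
    ... | inj₂ (there _ _ (there _ _ e)) =
      u≢x (shortest-halves-meet-at-junction uvx p₃ uvx++p₃-short (start uvx) (EdgeOn⇒∈ᵂ (EdgeOn-sym e)))

  ForcingNeighbour⇒¬Monitors : ∀ {v u s t} → ForcingNeighbour v u → s ≢ v → t ≢ v →
    ¬ Monitors G s t u v
  ForcingNeighbour⇒¬Monitors forcing s≢v t≢v mon@((_ , p) , through) with shortest p
  ... | k , q , q-short with EdgeOn-split (through k q q-short)
  ... | inj₁ (i , j , q₁ , huv , q₂ , refl) =
    ForcingNeighbour⇒¬Monitors-via forcing t≢v q₁ huv q₂ q-short mon
  ... | inj₂ (i , j , q₁ , hvu , q₂ , refl) =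
    ForcingNeighbour⇒¬Monitors-via forcing s≢v (reverse q₂) (Adj-sym hvu) (reverse q₁)
      (λ k′ r → subst (_≤ k′) (trans (+-comm i (suc j)) (sym (+-suc j i))) (q-short k′ (reverse r)))
      (Monitors-sym mon)

  Forced : Fin n → Set
  Forced v = (M : Subset n) → IsMEG G M → v ∈ M

  ForcingNeighbour⇒Forced : ∀ {v} → ∃ (ForcingNeighbour v) → Forced v
  ForcingNeighbour⇒Forced {v} (u , forcing@(hvu , _)) M meg = decidable-stable (v ∈? M) λ v∉M →
    let (s , t , s∈M , t∈M , mon) = meg u v (Adj-sym hvu)
    in ForcingNeighbour⇒¬Monitors forcing (∈≢ s∈M v∉M) (∈≢ t∈M v∉M) mon
    where
    ∈≢ : ∀ {x} → x ∈ M → ¬ v ∈ M → x ≢ v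
    ∈≢ x∈M v∉M refl = v∉M x∈M

  ∁⁅⁆-isMEG : ∀ {v} → (∀ u → ¬ ForcingNeighbour v u) → IsMEG G (∁ ⁅ v ⁆)
  ∁⁅⁆-isMEG {v} none a b hab with a ≟ v | b ≟ v
  ... | yes refl | yes refl = contradiction refl (Adj⇒≢ hab)
  ... | yes refl | no b≢v with ¬ForcingNeighbour⇒open-2path hab (none b)
  ...   | x , _ , bvx@(_ , hxv , _) , ¬square =
    b , x , x≢y⇒x∈∁⁅y⁆ b≢v , x≢y⇒x∈∁⁅y⁆ (Adj⇒≢ hxv) , Monitors-swapEdge (open-2path⇒Monitors bvx ¬square)
  ∁⁅⁆-isMEG none a b hab | no a≢v | yes refl with ¬ForcingNeighbour⇒open-2path (Adj-sym hab) (none a)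
  ...   | x , _ , avx@(_ , hxv , _) , ¬square =
    a , x , x≢y⇒x∈∁⁅y⁆ a≢v , x≢y⇒x∈∁⁅y⁆ (Adj⇒≢ hxv) , open-2path⇒Monitors avx ¬square
  ∁⁅⁆-isMEG none a b hab | no a≢v | no b≢v =
    a , b , x≢y⇒x∈∁⁅y⁆ a≢v , x≢y⇒x∈∁⁅y⁆ b≢v , Adj⇒Monitors hab

  Forced⇒ForcingNeighbour : ∀ {v} → Forced v → ∃ (ForcingNeighbour v)
  Forced⇒ForcingNeighbour {v} forced = decidable-stable (any? (ForcingNeighbour? v)) λ none →
    x∈∁p⇒x∉p (forced _ (∁⁅⁆-isMEG λ u forcing → none (u , forcing))) (x∈⁅x⁆ v)

mainTheorem3 : ∀ {n} (G : Graph n) (v : Fin n) →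
    ((M : Subset n) → IsMEG G M → v ∈ M) ⇔
    (∃[ u ] (Adj G v u × (∀ x → Adj G v x → Induced2Path G u v x →
      ∃[ w ] (w ≢ v × Adj G u w × Adj G x w))))
mainTheorem3 G v = mk⇔ (Forced⇒ForcingNeighbour G) (ForcingNeighbour⇒Forced G)
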